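{- Let $r \ge 3$. Then for every $n \ge 1$, $\omega^{\mathrm{DHJ}}_r(n) \le \omega_{\overline{Q}_r}(n)$.
   Context: Combinatorial lines: a combinatorial pattern over $[r]^n$ is a string $\underline{b} \in ([r]\cup\{\star\})^n \setminus [r]^n$ ($\star$ a wildcard). For $q\in[r]$, $\underline{b}(q)$ is obtained by replacing every $\star$ by $q$; the combinatorial line is $L(\underline{b})=\{\underline{b}(1),\dots,\underline{b}(r)\}$. For $S\subseteq[r]^n$, $\mu(S)=|S|/r^n$. $\omega^{\mathrm{DHJ}}_r(n)$ is the maximum of $\mu(S)$ over all $S\subseteq[r]^n$ containing no combinatorial line. Games: an $r$-prover question set is a finite nonempty $\overline{Q}\subseteq Q^{(1)}\times\cdots\times Q^{(r)}$ with finite $Q^{(j)}$ such that every element of each $Q^{(j)}$ occurs as a $j$-th coordinate of some tuple of $\overline{Q}$. An $r$-prover game with question set $\overline{Q}$ is $(\overline{Q},\overline{A},V)$ with $\overline{A}=A^{(1)}\times\cdots\times A^{(r)}$ a product of finite alphabets and $V:\overline{Q}\times\overline{A}\to\{0,1\}$. A strategy is $(\mathcal{S}^{(1)},\dots,\mathcal{S}^{(r)})$, $\mathcal{S}^{(j)}:Q^{(j)}\to A^{(j)}$; the value is the maximum over strategies of the probability, over $\overline{q}$ uniform on $\overline{Q}$, that $V(\overline{q},\mathcal{S}^{(1)}(q^{(1)}),\dots,\mathcal{S}^{(r)}(q^{(r)}))=1$. A game is trivial if its value is $1$. The $n$-fold parallel repetition $\mathcal{G}^n$ has question set $\overline{Q}^n$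 (prover $j$ gets the $n$ $j$-th coordinates), answer alphabets $(A^{(j)})^n$, and accepts iff $V$ accepts in all $n$ coordinates. $\omega_{\overline{Q}}(n)$ is the supremum of $\mathrm{val}(\mathcal{G}^n)$ over all non-trivial games $\mathcal{G}$ with question set $\overline{Q}$ (with arbitrary finite answer alphabets). $\overline{Q}_r$: $Q^{(j)}=\{0,1\}$ for all $j$, and $\overline{Q}_r=\{(q^{(1)},\dots,q^{(r)})\in\{0,1\}^r: \text{exactly one } q^{(j)} \text{ equals } 1\}$. -}

module Defs where

open import Data.Nat using (ℕ; zero; suc; _^_; _≡ᵇ_)
open import Data.Integer using (+_)
open import Data.Rational using (ℚ; _/_; _≤_; 0ℚ; 1ℚ)
open import Data.Bool using (Bool; true; false; if_then_else_)
open import Data.Fin using (Fin; zero; suc)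
open import Data.Maybe using (Maybe; nothing; just; fromMaybe)
open import Data.List using (List; []; _∷_; map; concatMap; length; filterᵇ; allFin)
open import Data.Bool.ListAction using (and)
open import Data.Nat.ListAction using (sum)
open import Data.Vec using (Vec; lookup) renaming ([] to []ᵥ; _∷_ to _∷ᵥ_; map to mapᵥ)
open import Data.Product using (Σ; ∃; _×_)
open import Relation.Binary.PropositionalEquality using (_≡_)
open import Relation.Nullary using (¬_)

vecs : {X : Set} → List X → (n : ℕ) → List (Vec X n)
vecs xs zero    = []ᵥ ∷ []
vecs xs (suc n) = concatMap (λ x → map (x ∷ᵥ_) (vecs xs n)) xs

-- the fraction w / d as a rational (d = 0 never occurs in our uses)
frac : ℕ → ℕ → ℚ
frac w zero    = 0ℚ
frac w (suc k) = (+ w) / suc k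

Word : ℕ → ℕ → Set
Word r n = Vec (Fin r) n

-- a pattern in ([r] ∪ {⋆})^n ; ⋆ is `nothing`
Pattern : ℕ → ℕ → Set
Pattern r n = Vec (Maybe (Fin r)) n

HasWildcard : {r n : ℕ} → Pattern r n → Set
HasWildcard {r} {n} b = Σ (Fin n) λ t → lookup b t ≡ nothing

instantiate : {r n : ℕ} → Pattern r n → Fin r → Word r n
instantiate b q = mapᵥ (fromMaybe q) b

-- subsets S ⊆ [r]^n are given by their (decidable) membership function
ContainsLine : {r n : ℕ} → (Word r n → Bool) → Set
ContainsLine {r} {n} S =
  Σ (Pattern r n) λ b → HasWildcard b × ((q : Fin r) → S (instantiate b q) ≡ true)

LineFree : {r n : ℕ} → (Word r n → Bool) → Set
LineFree S = ¬ ContainsLine S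

density : {r n : ℕ} → (Word r n → Bool) → ℚ
density {r} {n} S = frac (length (filterᵇ S (vecs (allFin r) n))) (r ^ n)

Tuple : {r : ℕ} → (Fin r → Set) → Set
Tuple {r} X = (j : Fin r) → X j

record Game (r : ℕ) (Q A : Fin r → Set) : Set where
  constructor mkGame
  field
    questions : List (Tuple Q)
    V         : Tuple Q → Tuple A → Bool
open Game public

Strategy : {r : ℕ} (Q A : Fin r → Set) → Set
Strategy {r} Q A = (j : Fin r) → Q j → A j

wins : {r : ℕ} {Q A : Fin r → Set} → Game r Q A → Strategy Q A → Tuple Q → Bool
wins G s q = V G q (λ j → s j (q j))

winProb : {r : ℕ} {Q A : Fin r → Set} → Game r Q A → Strategy Q A → ℚ
winProb G s = frac (length (filterᵇ (wins G s) (questions G))) (length (questions G))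

-- val(G) ≤ v   (val is the maximum over strategies of winProb)
ValueAtMost : {r : ℕ} {Q A : Fin r → Set} → Game r Q A → ℚ → Set
ValueAtMost G v = ∀ s → winProb G s ≤ v

Trivial : {r : ℕ} {Q A : Fin r → Set} → Game r Q A → Set
Trivial {Q = Q} {A} G = Σ (Strategy Q A) λ s → winProb G s ≡ 1ℚ

transposeT : {r n : ℕ} {Q : Fin r → Set} → Vec (Tuple Q) n → Tuple (λ j → Vec (Q j) n)
transposeT v j = mapᵥ (λ q → q j) v

repeat : {r : ℕ} {Q A : Fin r → Set} → Game r Q A → (n : ℕ) →
         Game r (λ j → Vec (Q j) n) (λ j → Vec (A j) n)
repeat {r} G n = mkGame
  (map transposeT (vecs (questions G) n))
  (λ qs as → and (map (λ t → V G (λ j → lookup (qs j) t) (λ j → lookup (as j) t)) (allFin n)))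

Bit : Set
Bit = Fin 2

isOne : Bit → Bool
isOne zero    = false
isOne (suc _) = true

exactlyOneᵇ : {r : ℕ} → Vec Bit r → Bool
exactlyOneᵇ {r} v = sum (map (λ j → if isOne (lookup v j) then 1 else 0) (allFin r)) ≡ᵇ 1

QBar : (r : ℕ) → List (Tuple {r} (λ _ → Bit))
QBar r = map lookup (filterᵇ exactlyOneᵇ (vecs (allFin 2) r))

QBarGame : (r : ℕ) (a : Fin r → ℕ) →
           (Tuple {r} (λ _ → Bit) → Tuple (λ j → Fin (a j)) → Bool) →
           Game r (λ _ → Bit) (λ j → Fin (a j))
QBarGame r a V = mkGame (QBar r) V

-- v is an upper bound for ω_{Q̄_r}(n) = sup { val(Gⁿ) : G non-trivial with question set Q̄_r }
UpperBoundωQBar : (r n : ℕ) → ℚ → Set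
UpperBoundωQBar r n v =
  (a : Fin r → ℕ) (V : Tuple {r} (λ _ → Bit) → Tuple (λ j → Fin (a j)) → Bool) →
  ¬ Trivial (QBarGame r a V) → ValueAtMost (repeat (QBarGame r a V) n) v

-- From a line-free S ⊆ [r]ⁿ we build a game on Q̄_r in which every prover answers
-- a coordinate t of the n-fold repetition together with a 0/1 string of length n.
-- The verifier reads the strings of the r provers as the indicator columns of a
-- single word w, checks that at coordinate t they reproduce the question, and
-- accepts iff w ∈ S. In the n-fold repetition, honest provers answer with their
-- whole question string, so they win exactly on the question tuples spelling a
-- word of S: val(Gⁿ) ≥ μ(S).
-- The game is non-trivial. In a perfect strategy prover j gives the same answer
-- on all unit questions e_i with i ≠ j, so at every coordinate the letters of the
-- accepted words w_i form, as a function of i, either a constant or the identity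
-- (this is where r ≥ 3 enters), and the coordinate named by prover 0 on bit 0
-- carries the identity. Hence the w_i form a combinatorial line inside S.
module Submission where

open import Defs
open import Data.Nat using (ℕ; zero; suc; _≤_; _+_; _*_; _^_; _≡ᵇ_; s≤s; z≤n)
open import Data.Nat.ListAction using (sum)
open import Data.Fin using (Fin; zero; suc; opposite; inject₁; fromℕ; combine; quotient; remainder; funToFin; finToFun)
open import Data.Fin.Properties using (_≟_; all?; ¬∀⟶∃¬; opposite-involutive; remQuot-combine; finToFun-funToFin)
open import Data.Bool using (Bool; true; false; if_then_else_; _∧_)
open import Data.Bool.Properties using (∧-conicalˡ; ∧-conicalʳ; ∧-identityʳ; ∧-idem; T-≡)
open import Data.Bool.ListAction using (and)
open import Data.Maybe using (Maybe; just; nothing; fromMaybe)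
open import Data.Integer using (+_)
import Data.Integer.Properties as ℤ
open import Data.Product using (∃; _×_; _,_; proj₁; proj₂)
open import Data.Sum using (_⊎_; inj₁; inj₂)
open import Data.List using (List; []; _∷_; [_]; _++_; map; concatMap; length; filterᵇ; allFin)
import Data.List as List
open import Data.List.Properties
  using (map-∘; map-cong; map-++; length-map; length-++; length-tabulate; map-tabulate;
         map-concatMap; concatMap-map; ++-identityʳ; filter-++; filter-complete)
open import Data.List.Relation.Unary.All as All using (All; []; _∷_)
open import Data.List.Relation.Unary.All.Properties using (map⁺; concat⁺; all-filter)
open import Data.List.Membership.Propositional using (_∈_)
open import Data.List.Membership.Propositional.Properties using (∈-map⁺; ∈-++⁺ˡ; ∈-++⁺ʳ)
open import Data.List.Relation.Unary.Any using (here)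
open import Data.Vec as Vec using (Vec) renaming (_∷_ to _∷ᵥ_)
open import Data.Vec.Properties using (lookup∘tabulate; tabulate∘lookup; tabulate-cong; tabulate-∘; lookup-map)
import Data.Vec.Relation.Unary.All as VecAll
open import Data.Vec.Relation.Unary.All.Properties using (lookup⁺)
open import Data.Rational using (ℚ; 1ℚ)
import Data.Rational as ℚ
open import Data.Rational.Properties using (/-injective-≃)
open import Data.Rational.Unnormalised using (mkℚᵘ; *≡*)
open import Function using (_∘_; id)
open import Function.Bundles using (Equivalence)
open import Relation.Binary.PropositionalEquality hiding ([_])
open import Relation.Nullary using (¬_; Dec; yes; no; does; contradiction)
open import Relation.Nullary.Decidable using (T?; dec-true; _×-dec_)

private
  variable
    A B : Set
    m n r : ℕ

filterᵇ-map : (p : B → Bool) (f : A → B) (xs : List A) →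
              filterᵇ p (map f xs) ≡ map f (filterᵇ (p ∘ f) xs)
filterᵇ-map p f []       = refl
filterᵇ-map p f (x ∷ xs) with p (f x)
... | true  = cong (f x ∷_) (filterᵇ-map p f xs)
... | false = filterᵇ-map p f xs

filterᵇ-cong : {p q : A → Bool} {xs : List A} → All (λ x → p x ≡ q x) xs → filterᵇ p xs ≡ filterᵇ q xs
filterᵇ-cong [] = refl
filterᵇ-cong {q = q} {xs = x ∷ _} (px≡qx ∷ rest) rewrite px≡qx with q x
... | true  = cong (x ∷_) (filterᵇ-cong rest)
... | false = filterᵇ-cong rest

filterᵇ-false : (xs : List A) → filterᵇ (λ _ → false) xs ≡ []
filterᵇ-false []       = refl
filterᵇ-false (x ∷ xs) = filterᵇ-false xs

and-map-const : {b : Bool} (f : A → Bool) (x : A) (xs : List A) → (∀ y → f y ≡ b) → and (map f (x ∷ xs)) ≡ b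
and-map-const {b = b} f x []       f≡b rewrite f≡b x = ∧-identityʳ b
and-map-const {b = b} f x (y ∷ xs) f≡b rewrite f≡b x | and-map-const f y xs f≡b = ∧-idem b

length-vecs : (xs : List A) (n : ℕ) → length (vecs xs n) ≡ length xs ^ n
length-vecs xs zero    = refl
length-vecs xs (suc n) = trans (length-prependEach xs) (cong (length xs *_) (length-vecs xs n))
  where
  length-prependEach : (ys : List _) →
    length (concatMap (λ y → map (y ∷ᵥ_) (vecs xs n)) ys) ≡ length ys * length (vecs xs n)
  length-prependEach []       = refl
  length-prependEach (y ∷ ys) = trans (length-++ (map (y ∷ᵥ_) (vecs xs n)))
                                      (cong₂ _+_ (length-map (y ∷ᵥ_) (vecs xs n)) (length-prependEach ys))

map-vecs : (f : A → B) (xs : List A) (n : ℕ) → map (Vec.map f) (vecs xs n) ≡ vecs (map f xs) n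
map-vecs f xs zero    = refl
map-vecs f xs (suc n) = begin
  map (Vec.map f) (concatMap (λ x → map (x ∷ᵥ_) (vecs xs n)) xs)
    ≡⟨ map-concatMap (Vec.map f) _ xs ⟩
  concatMap (λ x → map (Vec.map f) (map (x ∷ᵥ_) (vecs xs n))) xs
    ≡⟨ cong List.concat (map-cong (λ x → trans (sym (map-∘ (vecs xs n))) (map-∘ (vecs xs n))) xs) ⟩
  concatMap (λ x → map (f x ∷ᵥ_) (map (Vec.map f) (vecs xs n))) xs
    ≡⟨ concatMap-map _ f xs ⟨
  concatMap (λ y → map (y ∷ᵥ_) (map (Vec.map f) (vecs xs n))) (map f xs)
    ≡⟨ cong (λ vs → concatMap (λ y → map (y ∷ᵥ_) vs) (map f xs)) (map-vecs f xs n) ⟩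
  concatMap (λ y → map (y ∷ᵥ_) (vecs (map f xs) n)) (map f xs)
    ∎
  where open ≡-Reasoning

vecs-All : {P : A → Set} {xs : List A} → All P xs → (n : ℕ) → All (VecAll.All P) (vecs xs n)
vecs-All pxs zero    = VecAll.[] ∷ []
vecs-All pxs (suc n) = concat⁺ (map⁺ (All.map (λ px → map⁺ (All.map (px VecAll.∷_) (vecs-All pxs n))) pxs))

pattern b0 = zero
pattern b1 = suc zero

δ : Fin r → Fin r → Bit
δ i j = if does (i ≟ j) then b1 else b0

δ-refl : (i : Fin r) → δ i i ≡ b1
δ-refl i with i ≟ i
... | yes _  = refl
... | no i≢i = contradiction refl i≢i

δ-≢ : {i j : Fin r} → i ≢ j → δ i j ≡ b0
δ-≢ {i = i} {j} i≢j with i ≟ j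
... | yes i≡j = contradiction i≡j i≢j
... | no _    = refl

δ≡b1⇒≡ : {i j : Fin r} → δ i j ≡ b1 → i ≡ j
δ≡b1⇒≡ {i = i} {j} _ with i ≟ j
... | yes i≡j = i≡j

IsUnitVector : Fin r → (Fin r → Bit) → Set
IsUnitVector i q = ∀ j → q j ≡ δ i j

firstOne : (Fin (suc m) → Bit) → Fin (suc m)
firstOne {zero}  q = zero
firstOne {suc m} q = if isOne (q zero) then zero else suc (firstOne (q ∘ suc))

firstOne-unit : {i : Fin (suc m)} (q : Fin (suc m) → Bit) → IsUnitVector i q → firstOne q ≡ i
firstOne-unit {zero}  {zero}  q _ = refl
firstOne-unit {suc m} {zero}  q q≡δ rewrite q≡δ zero = refl
firstOne-unit {suc m} {suc i} q q≡δ rewrite q≡δ zero = cong suc (firstOne-unit (q ∘ suc) (q≡δ ∘ suc))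

-- QBar lists the unit vectors with the 1 moving from the last coordinate to the
-- first; reading a unit vector as a letter through opposite makes QBar spell
-- allFin in order.
letter : (Fin (suc m) → Bit) → Fin (suc m)
letter = opposite ∘ firstOne

unitTuple : Fin r → Fin r → Bit
unitTuple i = Vec.lookup (Vec.tabulate (δ i))

unitTuple-unit : (i : Fin r) → IsUnitVector i (unitTuple i)
unitTuple-unit i = lookup∘tabulate (δ i)

reverseFin : (r : ℕ) → List (Fin r)
reverseFin zero    = []
reverseFin (suc r) = map suc (reverseFin r) ++ [ zero ]

∈-reverseFin : (i : Fin r) → i ∈ reverseFin r
∈-reverseFin {suc r} zero    = ∈-++⁺ʳ (map suc (reverseFin r)) (here refl)
∈-reverseFin {suc r} (suc i) = ∈-++⁺ˡ (∈-map⁺ suc (∈-reverseFin i))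

allFin-snoc : (r : ℕ) → allFin (suc r) ≡ map inject₁ (allFin r) ++ [ fromℕ r ]
allFin-snoc zero    = refl
allFin-snoc (suc r) = cong (zero ∷_) (begin
  List.tabulate suc
    ≡⟨ map-tabulate id suc ⟨
  map suc (allFin (suc r))
    ≡⟨ cong (map suc) (allFin-snoc r) ⟩
  map suc (map inject₁ (allFin r) ++ [ fromℕ r ])
    ≡⟨ map-++ suc (map inject₁ (allFin r)) [ fromℕ r ] ⟩
  map suc (map inject₁ (allFin r)) ++ [ suc (fromℕ r) ]
    ≡⟨ cong (_++ [ suc (fromℕ r) ]) (trans (sym (map-∘ (allFin r))) (map-∘ (allFin r))) ⟩
  map inject₁ (map suc (allFin r)) ++ [ suc (fromℕ r) ]
    ≡⟨ cong (λ xs → map inject₁ xs ++ [ suc (fromℕ r) ]) (map-tabulate id suc) ⟩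
  map inject₁ (List.tabulate suc) ++ [ suc (fromℕ r) ]
    ∎)
  where open ≡-Reasoning

map-opposite-reverseFin : (r : ℕ) → map opposite (reverseFin r) ≡ allFin r
map-opposite-reverseFin zero    = refl
map-opposite-reverseFin (suc r) = begin
  map opposite (map suc (reverseFin r) ++ [ zero ])
    ≡⟨ map-++ opposite (map suc (reverseFin r)) [ zero ] ⟩
  map opposite (map suc (reverseFin r)) ++ [ fromℕ r ]
    ≡⟨ cong (_++ [ fromℕ r ]) (trans (sym (map-∘ (reverseFin r))) (map-∘ (reverseFin r))) ⟩
  map inject₁ (map opposite (reverseFin r)) ++ [ fromℕ r ]
    ≡⟨ cong (λ xs → map inject₁ xs ++ [ fromℕ r ]) (map-opposite-reverseFin r) ⟩
  map inject₁ (allFin r) ++ [ fromℕ r ]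
    ≡⟨ allFin-snoc r ⟨
  allFin (suc r)
    ∎
  where open ≡-Reasoning

bitVectors : (r : ℕ) → List (Vec Bit r)
bitVectors = vecs (allFin 2)

filterᵇ-bitVectors : (p : Vec Bit (suc r) → Bool) →
  filterᵇ p (bitVectors (suc r)) ≡
    map (b0 ∷ᵥ_) (filterᵇ (p ∘ (b0 ∷ᵥ_)) (bitVectors r)) ++
    map (b1 ∷ᵥ_) (filterᵇ (p ∘ (b1 ∷ᵥ_)) (bitVectors r))
filterᵇ-bitVectors {r} p =
  trans (filter-++ (T? ∘ p) (map (b0 ∷ᵥ_) (bitVectors r)) (map (b1 ∷ᵥ_) (bitVectors r) ++ []))
    (cong₂ _++_ (filterᵇ-map p (b0 ∷ᵥ_) (bitVectors r))
      (trans (filter-++ (T? ∘ p) (map (b1 ∷ᵥ_) (bitVectors r)) [])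
        (trans (++-identityʳ _) (filterᵇ-map p (b1 ∷ᵥ_) (bitVectors r)))))

ones : Vec Bit r → ℕ
ones v = sum (List.tabulate (λ j → if isOne (Vec.lookup v j) then 1 else 0))

exactlyOneᵇ-ones : (v : Vec Bit r) → exactlyOneᵇ v ≡ (ones v ≡ᵇ 1)
exactlyOneᵇ-ones v = cong (λ xs → sum xs ≡ᵇ 1) (map-tabulate id (λ j → if isOne (Vec.lookup v j) then 1 else 0))

filterᵇ-ones≡0 : (r : ℕ) → filterᵇ (λ v → ones v ≡ᵇ 0) (bitVectors r) ≡ [ Vec.tabulate (λ _ → b0) ]
filterᵇ-ones≡0 zero    = refl
filterᵇ-ones≡0 (suc r) =
  trans (filterᵇ-bitVectors _)
    (cong₂ _++_ (cong (map (b0 ∷ᵥ_)) (filterᵇ-ones≡0 r)) (cong (map (b1 ∷ᵥ_)) (filterᵇ-false (bitVectors r))))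

filterᵇ-ones≡1 : (r : ℕ) → filterᵇ (λ v → ones v ≡ᵇ 1) (bitVectors r) ≡ map (Vec.tabulate ∘ δ) (reverseFin r)
filterᵇ-ones≡1 zero    = refl
filterᵇ-ones≡1 (suc r) = begin
  filterᵇ (λ v → ones v ≡ᵇ 1) (bitVectors (suc r))
    ≡⟨ filterᵇ-bitVectors _ ⟩
  map (b0 ∷ᵥ_) (filterᵇ (λ v → ones v ≡ᵇ 1) (bitVectors r)) ++
  map (b1 ∷ᵥ_) (filterᵇ (λ v → ones v ≡ᵇ 0) (bitVectors r))
    ≡⟨ cong₂ _++_ (cong (map (b0 ∷ᵥ_)) (filterᵇ-ones≡1 r)) (cong (map (b1 ∷ᵥ_)) (filterᵇ-ones≡0 r)) ⟩
  map (b0 ∷ᵥ_) (map (Vec.tabulate ∘ δ) (reverseFin r)) ++ [ Vec.tabulate (δ zero) ]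
    ≡⟨ cong (_++ [ Vec.tabulate (δ zero) ]) (trans (sym (map-∘ (reverseFin r))) (map-∘ (reverseFin r))) ⟩
  map (Vec.tabulate ∘ δ) (map suc (reverseFin r)) ++ [ Vec.tabulate (δ zero) ]
    ≡⟨ map-++ (Vec.tabulate ∘ δ) (map suc (reverseFin r)) [ zero ] ⟨
  map (Vec.tabulate ∘ δ) (reverseFin (suc r))
    ∎
  where open ≡-Reasoning

QBar≡unitTuples : (r : ℕ) → QBar r ≡ map unitTuple (reverseFin r)
QBar≡unitTuples r = begin
  map Vec.lookup (filterᵇ exactlyOneᵇ (bitVectors r))
    ≡⟨ cong (map Vec.lookup) (filterᵇ-cong (All.universal exactlyOneᵇ-ones (bitVectors r))) ⟩
  map Vec.lookup (filterᵇ (λ v → ones v ≡ᵇ 1) (bitVectors r))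
    ≡⟨ cong (map Vec.lookup) (filterᵇ-ones≡1 r) ⟩
  map Vec.lookup (map (Vec.tabulate ∘ δ) (reverseFin r))
    ≡⟨ map-∘ (reverseFin r) ⟨
  map unitTuple (reverseFin r)
    ∎
  where open ≡-Reasoning

unitTuple∈QBar : (i : Fin r) → unitTuple i ∈ QBar r
unitTuple∈QBar {r} i = subst (unitTuple i ∈_) (sym (QBar≡unitTuples r)) (∈-map⁺ unitTuple (∈-reverseFin i))

QBar-units : (m : ℕ) → All (λ q → IsUnitVector (firstOne q) q) (QBar (suc m))
QBar-units m = subst (All (λ q → IsUnitVector (firstOne q) q)) (sym (QBar≡unitTuples (suc m)))
                     (map⁺ (All.universal unit (reverseFin (suc m))))
  where
  unit : (i : Fin (suc m)) → IsUnitVector (firstOne (unitTuple i)) (unitTuple i)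
  unit i rewrite firstOne-unit {i = i} (unitTuple i) (unitTuple-unit i) = unitTuple-unit i

map-letter-QBar : (m : ℕ) → map letter (QBar (suc m)) ≡ allFin (suc m)
map-letter-QBar m = begin
  map letter (QBar (suc m))
    ≡⟨ cong (map letter) (QBar≡unitTuples (suc m)) ⟩
  map letter (map unitTuple (reverseFin (suc m)))
    ≡⟨ map-∘ (reverseFin (suc m)) ⟨
  map (letter ∘ unitTuple) (reverseFin (suc m))
    ≡⟨ map-cong (λ i → cong opposite (firstOne-unit {i = i} (unitTuple i) (unitTuple-unit i))) (reverseFin (suc m)) ⟩
  map opposite (reverseFin (suc m))
    ≡⟨ map-opposite-reverseFin (suc m) ⟩
  allFin (suc m)
    ∎
  where open ≡-Reasoning

length-QBar : (m : ℕ) → length (QBar (suc m)) ≡ suc m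
length-QBar m = begin
  length (QBar (suc m))              ≡⟨ length-map letter (QBar (suc m)) ⟨
  length (map letter (QBar (suc m))) ≡⟨ cong length (map-letter-QBar m) ⟩
  length (allFin (suc m))            ≡⟨ length-tabulate id ⟩
  suc m                              ∎
  where open ≡-Reasoning

Answer : ℕ → Set
Answer n = Fin (n * 2 ^ n)

encodeAnswer : Fin n → (Fin n → Bit) → Answer n
encodeAnswer t c = combine t (funToFin c)

answerCoordinate : Answer n → Fin n
answerCoordinate {n} = quotient (2 ^ n)

answerBits : Answer n → Fin n → Bit
answerBits {n} a = finToFun (remainder {n} (2 ^ n) a)

answerCoordinate-encode : (t : Fin n) (c : Fin n → Bit) → answerCoordinate (encodeAnswer t c) ≡ t
answerCoordinate-encode {n} t c = cong proj₁ (remQuot-combine {n} {2 ^ n} t (funToFin c))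

answerBits-encode : (t : Fin n) (c : Fin n → Bit) (u : Fin n) → answerBits (encodeAnswer t c) u ≡ c u
answerBits-encode {n} t c u =
  trans (cong (λ tc → finToFun (proj₂ tc) u) (remQuot-combine {n} {2 ^ n} t (funToFin c))) (finToFun-funToFin c u)

column : (Fin r → Fin n → Bit) → Fin n → Fin r → Bit
column cs u j = cs j u

decodeWord : (Fin (suc m) → Fin n → Bit) → Word (suc m) n
decodeWord cs = Vec.tabulate (λ u → letter (column cs u))

Consistent : (Fin (suc m) → Bit) → Fin n → (Fin (suc m) → Fin n → Bit) → Set
Consistent q t cs = (∀ j u → cs j u ≡ δ (firstOne (column cs u)) j) × (∀ j → cs j t ≡ q j)

consistent? : (q : Fin (suc m) → Bit) (t : Fin n) (cs : Fin (suc m) → Fin n → Bit) → Dec (Consistent q t cs)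
consistent? q t cs = all? (λ j → all? (λ u → cs j u ≟ δ (firstOne (column cs u)) j)) ×-dec all? (λ j → cs j t ≟ q j)

module _ (S : Word (suc m) n → Bool) where

  lineVerifier : Tuple {suc m} (λ _ → Bit) → Tuple {suc m} (λ _ → Answer n) → Bool
  lineVerifier q a = does (consistent? q (answerCoordinate (a zero)) cs) ∧ S (decodeWord cs)
    where
    cs : Fin (suc m) → Fin n → Bit
    cs j = answerBits (a j)

  lineGame : Game (suc m) (λ _ → Bit) (λ _ → Answer n)
  lineGame = QBarGame (suc m) (λ _ → n * 2 ^ n) lineVerifier

  lineVerifier-honest : (qs : Vec (Fin (suc m) → Bit) n) → VecAll.All (λ q → IsUnitVector (firstOne q) q) qs →
    (t : Fin n) (q : Fin (suc m) → Bit) (a : Fin (suc m) → Answer n) →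
    answerCoordinate (a zero) ≡ t → (∀ j u → answerBits (a j) u ≡ Vec.lookup qs u j) →
    (∀ j → q j ≡ Vec.lookup qs t j) →
    lineVerifier q a ≡ S (Vec.map letter qs)
  lineVerifier-honest qs units t q a coordinate≡t bits≡qs q≡qs =
    cong₂ _∧_ (dec-true (consistent? q (answerCoordinate (a zero)) cs) consistent) (cong S decodeWord≡)
    where
    cs : Fin (suc m) → Fin n → Bit
    cs j = answerBits (a j)
    column-unit : ∀ u → IsUnitVector (firstOne (Vec.lookup qs u)) (column cs u)
    column-unit u j = trans (bits≡qs j u) (lookup⁺ units u j)
    firstOne-column : ∀ u → firstOne (column cs u) ≡ firstOne (Vec.lookup qs u)
    firstOne-column u = firstOne-unit (column cs u) (column-unit u)
    consistent : Consistent q (answerCoordinate (a zero)) cs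
    consistent = (λ j u → trans (column-unit u j) (cong (λ k → δ k j) (sym (firstOne-column u))))
               , (λ j → trans (cong (cs j) coordinate≡t) (trans (bits≡qs j t) (sym (q≡qs j))))
    decodeWord≡ : decodeWord cs ≡ Vec.map letter qs
    decodeWord≡ = begin
      Vec.tabulate (λ u → letter (column cs u))      ≡⟨ tabulate-cong (cong opposite ∘ firstOne-column) ⟩
      Vec.tabulate (letter ∘ Vec.lookup qs)          ≡⟨ tabulate-∘ letter (Vec.lookup qs) ⟩
      Vec.map letter (Vec.tabulate (Vec.lookup qs))  ≡⟨ cong (Vec.map letter) (tabulate∘lookup qs) ⟩
      Vec.map letter qs                              ∎
      where open ≡-Reasoning

honestStrategy : Strategy {suc m} (λ _ → Vec Bit n) (λ _ → Vec (Answer n) n)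
honestStrategy j c = Vec.tabulate (λ t → encodeAnswer t (Vec.lookup c))

module _ {n : ℕ} (S : Word (suc m) (suc n) → Bool) where

  honest-wins : (qs : Vec (Fin (suc m) → Bit) (suc n)) → VecAll.All (λ q → IsUnitVector (firstOne q) q) qs →
    wins (repeat (lineGame S) (suc n)) honestStrategy (transposeT qs) ≡ S (Vec.map letter qs)
  honest-wins qs units = and-map-const _ zero (List.tabulate suc) (λ t →
    lineVerifier-honest S qs units t (λ j → Vec.lookup (transposeT qs j) t)
      (λ j → Vec.lookup (honestStrategy j (transposeT qs j)) t) (coordinate t) (bits t) (λ j → lookup-map t (λ q → q j) qs))
    where
    answer : ∀ t j → Vec.lookup (honestStrategy j (transposeT qs j)) t ≡ encodeAnswer t (Vec.lookup (transposeT qs j))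
    answer t j = lookup∘tabulate (λ t → encodeAnswer t (Vec.lookup (transposeT qs j))) t
    coordinate : ∀ t → answerCoordinate (Vec.lookup (honestStrategy {m} zero (transposeT qs zero)) t) ≡ t
    coordinate t = trans (cong answerCoordinate (answer t zero)) (answerCoordinate-encode t (Vec.lookup (transposeT qs zero)))
    bits : ∀ t j u → answerBits (Vec.lookup (honestStrategy j (transposeT qs j)) t) u ≡ Vec.lookup qs u j
    bits t j u = trans (cong (λ a → answerBits a u) (answer t j))
                       (trans (answerBits-encode t (Vec.lookup (transposeT qs j)) u) (lookup-map u (λ q → q j) qs))

  winProb-honest : winProb (repeat (lineGame S) (suc n)) honestStrategy ≡ density S
  winProb-honest = cong₂ frac numerator denominator
    where
    X : List (Vec (Fin (suc m) → Bit) (suc n))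
    X = vecs (QBar (suc m)) (suc n)
    winsHonest : Tuple {suc m} (λ _ → Vec Bit (suc n)) → Bool
    winsHonest = wins (repeat (lineGame S) (suc n)) honestStrategy
    open ≡-Reasoning
    numerator : length (filterᵇ winsHonest (map transposeT X)) ≡ length (filterᵇ S (vecs (allFin (suc m)) (suc n)))
    numerator = begin
      length (filterᵇ winsHonest (map transposeT X))
        ≡⟨ cong length (filterᵇ-map winsHonest transposeT X) ⟩
      length (map transposeT (filterᵇ (winsHonest ∘ transposeT) X))
        ≡⟨ length-map transposeT (filterᵇ (winsHonest ∘ transposeT) X) ⟩
      length (filterᵇ (winsHonest ∘ transposeT) X)
        ≡⟨ cong length (filterᵇ-cong (All.map (honest-wins _) (vecs-All (QBar-units m) (suc n)))) ⟩
      length (filterᵇ (S ∘ Vec.map letter) X)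
        ≡⟨ length-map (Vec.map letter) (filterᵇ (S ∘ Vec.map letter) X) ⟨
      length (map (Vec.map letter) (filterᵇ (S ∘ Vec.map letter) X))
        ≡⟨ cong length (filterᵇ-map S (Vec.map letter) X) ⟨
      length (filterᵇ S (map (Vec.map letter) X))
        ≡⟨ cong (length ∘ filterᵇ S) (trans (map-vecs letter (QBar (suc m)) (suc n))
                                            (cong (λ xs → vecs xs (suc n)) (map-letter-QBar m))) ⟩
      length (filterᵇ S (vecs (allFin (suc m)) (suc n)))
        ∎
    denominator : length (map transposeT X) ≡ suc m ^ suc n
    denominator = begin
      length (map transposeT X)      ≡⟨ length-map transposeT X ⟩
      length X                       ≡⟨ length-vecs (QBar (suc m)) (suc n) ⟩
      length (QBar (suc m)) ^ suc n  ≡⟨ cong (_^ suc n) (length-QBar m) ⟩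
      suc m ^ suc n                  ∎

IdOrConstant : (Fin r → Fin r) → Set
IdOrConstant f = (∀ i → f i ≡ i) ⊎ (∀ i i' → f i ≡ f i')

avoid₂ : (x y : Fin (3 + m)) → ∃ λ z → z ≢ x × z ≢ y
avoid₂ x y with zero ≟ x | zero ≟ y | suc zero ≟ x | suc zero ≟ y
... | no 0≢x   | no 0≢y   | _        | _        = zero , 0≢x , 0≢y
... | _        | _        | no 1≢x   | no 1≢y   = suc zero , 1≢x , 1≢y
... | yes refl | _        | _        | yes refl = suc (suc zero) , (λ ()) , (λ ())
... | _        | yes refl | yes refl | _        = suc (suc zero) , (λ ()) , (λ ())
... | yes refl | _        | yes ()   | _
... | _        | yes refl | _        | yes ()

-- If f moves some i, then g (f i) = b1, so every i' ≢ f i is sent to f i; a third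
-- letter besides f i and f (f i) shows that f (f i) = f i as well.
idOrConstant : (f : Fin (3 + m) → Fin (3 + m)) (g : Fin (3 + m) → Bit) →
               (∀ {i j} → i ≢ j → δ (f i) j ≡ g j) → IdOrConstant f
idOrConstant {m} f g rel with all? (λ i → f i ≟ i)
... | yes fixed = inj₁ fixed
... | no ¬fixed = inj₂ (λ i i' → trans (f≡k i) (sym (f≡k i')))
  where
  moved : ∃ λ i → f i ≢ i
  moved = ¬∀⟶∃¬ _ (λ i → f i ≡ i) (λ i → f i ≟ i) ¬fixed
  k : Fin (3 + m)
  k = f (proj₁ moved)
  hit : ∀ {i j} → g j ≡ b1 → i ≢ j → f i ≡ j
  hit gj≡b1 i≢j = δ≡b1⇒≡ (trans (rel i≢j) gj≡b1)
  marked : ∀ {i} → f i ≢ i → g (f i) ≡ b1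
  marked {i} fi≢i = trans (sym (rel (fi≢i ∘ sym))) (δ-refl (f i))
  fk≡k : f k ≡ k
  fk≡k with f k ≟ k
  ... | yes fk≡k = fk≡k
  ... | no fk≢k with avoid₂ k (f k)
  ...   | z , z≢k , z≢fk = contradiction (trans (sym (hit (marked fk≢k) z≢fk)) (hit (marked (proj₂ moved)) z≢k)) fk≢k
  f≡k : ∀ i → f i ≡ k
  f≡k i with i ≟ k
  ... | yes refl = fk≡k
  ... | no i≢k   = hit (marked (proj₂ moved)) i≢k

opposite-conj-fixed : {f : Fin r → Fin r} → (∀ i → f i ≡ i) → ∀ i → opposite (f (opposite i)) ≡ i
opposite-conj-fixed fixed i = trans (cong opposite (fixed (opposite i))) (opposite-involutive i)

IdOrConstant-opposite : {f : Fin r → Fin r} → IdOrConstant f → IdOrConstant (opposite ∘ f ∘ opposite)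
IdOrConstant-opposite (inj₁ fixed) = inj₁ (opposite-conj-fixed fixed)
IdOrConstant-opposite (inj₂ const) = inj₂ (λ i i' → cong opposite (const (opposite i) (opposite i')))

patternLetter : {f : Fin (suc r) → Fin (suc r)} → IdOrConstant f → Maybe (Fin (suc r))
patternLetter          (inj₁ _) = nothing
patternLetter {f = f} (inj₂ _) = just (f zero)

fromMaybe-patternLetter : {f : Fin (suc r) → Fin (suc r)} (c : IdOrConstant f) (i : Fin (suc r)) →
                          fromMaybe i (patternLetter c) ≡ f i
fromMaybe-patternLetter (inj₁ fixed) i = sym (fixed i)
fromMaybe-patternLetter (inj₂ const) i = const zero i

lineOfColumns : (S : Word (2 + r) n → Bool) (ws : Fin (2 + r) → Fin n → Fin (2 + r)) →
  (∀ u → IdOrConstant (λ i → ws i u)) → (u₀ : Fin n) → (∀ i → ws i u₀ ≡ i) →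
  (∀ i → S (Vec.tabulate (ws i)) ≡ true) → ContainsLine S
lineOfColumns {r} {n} S ws columns u₀ fixed inS =
  b , (u₀ , wildcard) , λ i → subst (λ w → S w ≡ true) (sym (instantiate-b i)) (inS i)
  where
  b : Pattern (2 + r) n
  b = Vec.tabulate (λ u → patternLetter (columns u))
  wildcard : Vec.lookup b u₀ ≡ nothing
  wildcard with columns u₀ | lookup∘tabulate (λ u → patternLetter (columns u)) u₀
  ... | inj₁ _     | b[u₀]≡nothing = b[u₀]≡nothing
  ... | inj₂ const | _ = contradiction (trans (sym (fixed zero)) (trans (const zero (suc zero)) (fixed (suc zero)))) (λ ())
  instantiate-b : ∀ i → instantiate b i ≡ Vec.tabulate (ws i)
  instantiate-b i = trans (sym (tabulate-∘ (fromMaybe i) (λ u → patternLetter (columns u))))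
                          (tabulate-cong (λ u → fromMaybe-patternLetter (columns u) i))

frac≡1 : (w d : ℕ) → frac w d ≡ 1ℚ → w ≡ d
frac≡1 w zero    ()
frac≡1 w (suc k) w/d≡1 with /-injective-≃ (mkℚᵘ (+ w) k) (mkℚᵘ (+ 1) 0) w/d≡1
... | *≡* w*1≡1*d = ℤ.+-injective (trans (sym (ℤ.*-identityʳ (+ w))) (trans w*1≡1*d (ℤ.*-identityˡ _)))

winProb≡1⇒wins : {Q A : Fin r → Set} (G : Game r Q A) (s : Strategy Q A) →
                 winProb G s ≡ 1ℚ → All (λ q → wins G s q ≡ true) (questions G)
winProb≡1⇒wins G s winProb≡1 =
  subst (All (λ q → wins G s q ≡ true)) (filter-complete (T? ∘ wins G s) (frac≡1 _ _ winProb≡1))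
    (All.map (Equivalence.to T-≡) (all-filter (T? ∘ wins G s) (questions G)))

witness : {P : Set} (P? : Dec P) → does P? ≡ true → P
witness (yes p) _ = p

module PerfectStrategy {m n : ℕ} (S : Word (3 + m) n → Bool)
  (s : Strategy {3 + m} (λ _ → Bit) (λ _ → Answer n))
  (won : All (λ q → wins (lineGame S) s q ≡ true) (QBar (3 + m))) where

  bits : Fin (3 + m) → Fin (3 + m) → Fin n → Bit
  bits i j = answerBits (s j (unitTuple i j))

  coordinate : Fin (3 + m) → Fin n
  coordinate i = answerCoordinate (s zero (unitTuple i zero))

  accepted : ∀ i → lineVerifier S (unitTuple i) (λ j → s j (unitTuple i j)) ≡ true
  accepted i = All.lookup won (unitTuple∈QBar i)

  consistent : ∀ i → Consistent (unitTuple i) (coordinate i) (bits i)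
  consistent i = witness (consistent? (unitTuple i) (coordinate i) (bits i)) (∧-conicalˡ _ _ (accepted i))

  ws : Fin (3 + m) → Fin n → Fin (3 + m)
  ws i u = firstOne (column (bits i) u)

  idleBits : Fin (3 + m) → Fin n → Bit
  idleBits j = answerBits (s j b0)

  bits-idle : ∀ {i j} → i ≢ j → ∀ u → bits i j u ≡ idleBits j u
  bits-idle {i} {j} i≢j u = cong (λ b → answerBits (s j b) u) (trans (unitTuple-unit i j) (δ-≢ i≢j))

  columns : ∀ u → IdOrConstant (λ i → ws i u)
  columns u = idOrConstant (λ i → ws i u) (λ j → idleBits j u)
    (λ {i} {j} i≢j → trans (sym (proj₁ (consistent i) j u)) (bits-idle i≢j u))

  T : Fin n
  T = answerCoordinate (s zero b0)

  ws-T : ∀ i → i ≢ zero → ws i T ≡ i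
  ws-T i i≢0 = δ≡b1⇒≡ (begin
    δ (ws i T) i             ≡⟨ proj₁ (consistent i) i T ⟨
    bits i i T               ≡⟨ cong (bits i i) coordinate≡T ⟨
    bits i i (coordinate i)  ≡⟨ proj₂ (consistent i) i ⟩
    unitTuple i i            ≡⟨ unitTuple-unit i i ⟩
    δ i i                    ≡⟨ δ-refl i ⟩
    b1                       ∎)
    where
    open ≡-Reasoning
    coordinate≡T : coordinate i ≡ T
    coordinate≡T = cong (λ b → answerCoordinate (s zero b)) (trans (unitTuple-unit i zero) (δ-≢ i≢0))

  column-T-fixed : ∀ i → ws i T ≡ i
  column-T-fixed with columns T
  ... | inj₁ fixed = fixed
  ... | inj₂ const = contradiction
    (trans (sym (ws-T (suc zero) (λ ()))) (trans (const (suc zero) (suc (suc zero))) (ws-T (suc (suc zero)) (λ ()))))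
    (λ ())

  line : ContainsLine S
  line = lineOfColumns S (λ q u → opposite (ws (opposite q) u)) (λ u → IdOrConstant-opposite (columns u))
                       T (opposite-conj-fixed column-T-fixed) (λ q → ∧-conicalʳ _ _ (accepted (opposite q)))

lineFree⇒nonTrivial : (S : Word (3 + m) n → Bool) → LineFree S → ¬ Trivial (lineGame S)
lineFree⇒nonTrivial S lineFree (s , winProb≡1) =
  lineFree (PerfectStrategy.line S s (winProb≡1⇒wins (lineGame S) s winProb≡1))

theorem1p8 : (r : ℕ) → 3 ≤ r → (n : ℕ) → 1 ≤ n →
    (S : Word r n → Bool) → LineFree S →
    (v : ℚ) → UpperBoundωQBar r n v → density S ℚ.≤ v
theorem1p8 (suc (suc (suc m))) (s≤s (s≤s (s≤s z≤n))) (suc n) (s≤s z≤n) S lineFree v bound =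
  subst (ℚ._≤ v) (winProb-honest S)
    (bound (λ _ → suc n * 2 ^ suc n) (lineVerifier S) (lineFree⇒nonTrivial S lineFree) honestStrategy)
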